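{- In a frieze of type $D_n$, two tagged arcs of weight $1$ cannot cross (i.e., any two tagged arcs of weight $1$ are compatible).
   Context: A frieze of type $D_n$ is a ring homomorphism from the coefficient-free cluster algebra of type $D_n$ to $\mathbb{Z}$ sending every cluster variable to a positive integer. Via Schiffler's model, cluster variables of type $D_n$ correspond to tagged arcs in a once-punctured $n$-gon, and a frieze is an assignment of positive integer weights to tagged arcs (boundary segments having weight $1$) satisfying all exchange relations. Two tagged arcs cross if they are not compatible (cannot lie in a common tagged triangulation). -}

module Defs where

open import Data.Nat using (ℕ; zero; suc; _+_; _*_; _∸_; _≤_; _<_; _≤ᵇ_; _≤?_)
open import Data.Fin using (Fin; toℕ; _≟_)
open import Data.Bool using (if_then_else_)
open import Data.Product using (_×_)
open import Data.Sum using (_⊎_)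
open import Data.Empty using (⊥)
open import Relation.Nullary using (¬_; Dec; yes; no)
open import Relation.Binary.PropositionalEquality using (_≡_; _≢_)

-- Once-punctured n-gon: boundary marked points 0,1,…,n-1 (Fin n) in
-- counterclockwise order, and one puncture in the interior.

dist : (n : ℕ) → Fin n → Fin n → ℕ
dist n i j = if toℕ i ≤ᵇ toℕ j then toℕ j ∸ toℕ i else (n + toℕ j) ∸ toℕ i

InOpen : (n : ℕ) → Fin n → Fin n → Fin n → Set
InOpen n i j k = (0 < dist n i k) × (dist n i k < dist n i j)

SubInterval : (n : ℕ) → Fin n → Fin n → Fin n → Fin n → Set
SubInterval n i j k l = dist n i k + dist n k l ≤ dist n i j

-- Tagged arcs of the once-punctured n-gon.
--  * ord i j : the (ordinary) arc from boundary point i to boundary point j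
--    which, together with the boundary path i, i+1, …, j (ccw), bounds a
--    disc NOT containing the puncture.  It is a genuine arc (neither a
--    boundary segment nor a loop) iff dist i j ≥ 2.
--  * plain i / notched i : the arc from i to the puncture, with plain resp.
--    notched tagging at the puncture.
data TArc (n : ℕ) : Set where
  ord     : (i j : Fin n) → 2 ≤ dist n i j → TArc n
  plain   : Fin n → TArc n
  notched : Fin n → TArc n

EndOK : (n : ℕ) → Fin n → Fin n → Fin n → Fin n → Set
EndOK n i j k l = ((¬ InOpen n i j k) × (¬ InOpen n i j l)) ⊎ SubInterval n i j k l

Crosses : {n : ℕ} → TArc n → TArc n → Set
Crosses {n} (ord i j _) (ord k l _) = ¬ (EndOK n i j k l × EndOK n k l i j)
Crosses {n} (ord i j _) (plain k)   = InOpen n i j k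
Crosses {n} (ord i j _) (notched k) = InOpen n i j k
Crosses {n} (plain k)   (ord i j _) = InOpen n i j k
Crosses {n} (notched k) (ord i j _) = InOpen n i j k
Crosses (plain i)   (plain j)   = ⊥
Crosses (notched i) (notched j) = ⊥
Crosses (plain i)   (notched j) = i ≢ j
Crosses (notched i) (plain j)   = i ≢ j

Compatible : {n : ℕ} → TArc n → TArc n → Set
Compatible α β = ¬ Crosses α β

-- Weight of the curve between boundary points i and j (ccw convention as for
-- ord), extended to degenerate cases:
--  * a boundary segment (dist i j = 1) has weight 1;
--  * for i = j, the loop at i around the puncture, whose value in the cluster
--    algebra is the product of the plain and notched arcs at i.
private
  Xaux : {n : ℕ} → (TArc n → ℕ) → (i j : Fin n) → Dec (2 ≤ dist n i j) → Dec (i ≡ j) → ℕ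
  Xaux w i j (yes p) _       = w (ord i j p)
  Xaux w i j (no _)  (yes _) = w (plain i) * w (notched i)
  Xaux w i j (no _)  (no _)  = 1

X : {n : ℕ} → (TArc n → ℕ) → Fin n → Fin n → ℕ
X {n} w i j = Xaux w i j (2 ≤? dist n i j) (i ≟ j)

-- A frieze of type D_n: positive integer weights on tagged arcs satisfying
-- all exchange relations (Schiffler's model).
record IsFrieze (n : ℕ) (w : TArc n → ℕ) : Set where
  field
    positive : ∀ γ → 1 ≤ w γ
    -- ordinary arcs ord i j and ord k l crossing once
    -- (i, k, j, l in ccw order; l = i allowed, the loop then appears)
    exch-ord : ∀ i j k l → InOpen n i j k → (InOpen n j i l ⊎ l ≡ i) →
      X w i j * X w k l ≡ X w i k * X w j l + X w k j * X w i l
    exch-plain : ∀ i j k → InOpen n i j k →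
      X w i j * w (plain k) ≡ X w i k * w (plain j) + X w k j * w (plain i)
    exch-notched : ∀ i j k → InOpen n i j k →
      X w i j * w (notched k) ≡ X w i k * w (notched j) + X w k j * w (notched i)
    -- plain arc at i and notched arc at j ≠ i (flip in a punctured digon)
    exch-tag : ∀ i j → i ≢ j →
      w (plain i) * w (notched j) ≡ X w i j + X w j i

-- If the arc ij has weight 1, the exchange relation between ij and an arc from a
-- point k strictly inside (i, j) to the puncture reads t(k) = X(i,k) t(j) + X(k,j) t(i),
-- where t is the weight of plain (resp. notched) arcs to the puncture.  Hence such
-- arcs are strictly heavier than the ones at i and j, so they do not have weight 1.
-- Two crossing ordinary arcs of weight 1 would each have an endpoint strictly inside
-- the other, giving t(k) > t(i) > t(k).  A plain arc at i and a notched arc at j ≠ i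
-- of weight 1 would give 1 = X(i,j) + X(j,i) ≥ 2.
module Submission where

open import Data.Nat
open import Data.Nat.Properties
open import Data.Nat.Tactic.RingSolver using (solve-∀)
open import Data.Fin using (Fin; toℕ) renaming (_≟_ to _≟ᶠ_)
open import Data.Fin.Properties using (toℕ<n)
open import Data.Bool using (true; false; T)
open import Data.Product using (_×_; _,_; proj₁; proj₂; Σ-syntax)
open import Data.Sum using (_⊎_; inj₁; inj₂; fromInj₁)
open import Data.Empty using (⊥-elim)
open import Function using (_∘_)
open import Relation.Nullary using (¬_; Dec; yes; no; contradiction)
open import Relation.Nullary.Decidable using (_×-dec_)
open import Relation.Binary.PropositionalEquality

open import Defs

+-turns : ∀ {a b x y z k m : ℕ} → a + x ≡ k + y → b + y ≡ m + z → (a + b) + x ≡ (k + m) + z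
+-turns {a} {b} {x} {y} {z} {k} {m} e f = begin
  (a + b) + x ≡⟨ swap a b x ⟩
  (a + x) + b ≡⟨ cong (_+ b) e ⟩
  (k + y) + b ≡⟨ swap k b y ⟨
  (k + b) + y ≡⟨ +-assoc k b y ⟩
  k + (b + y) ≡⟨ cong (k +_) f ⟩
  k + (m + z) ≡⟨ +-assoc k m z ⟨
  (k + m) + z ∎
  where
  open ≡-Reasoning
  swap : ∀ p q r → (p + q) + r ≡ (p + r) + q
  swap = solve-∀

cancel-turns : ∀ {s c x z k m : ℕ} → s + x ≡ k + z → c + x ≡ m + z → s + m ≡ k + c
cancel-turns {s} {c} {x} {z} {k} {m} e f = +-cancelʳ-≡ (x + z) (s + m) (k + c) (begin
  (s + m) + (x + z) ≡⟨ shuffle s m x z ⟩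
  (s + x) + (m + z) ≡⟨ cong₂ _+_ e (sym f) ⟩
  (k + z) + (c + x) ≡⟨ shuffle′ k z c x ⟩
  (k + c) + (x + z) ∎)
  where
  open ≡-Reasoning
  shuffle : ∀ p q r t → (p + q) + (r + t) ≡ (p + r) + (q + t)
  shuffle = solve-∀
  shuffle′ : ∀ p q r t → (p + q) + (r + t) ≡ (p + r) + (t + q)
  shuffle′ = solve-∀

module _ {n : ℕ} where

  Turn : ℕ → Set
  Turn k = k ≡ 0 ⊎ k ≡ n

  dist-turn : ∀ (x y : Fin n) → Σ[ k ∈ ℕ ] Turn k × dist n x y + toℕ x ≡ k + toℕ y
  dist-turn x y with toℕ x ≤ᵇ toℕ y in eq
  ... | true  = 0 , inj₁ refl , m∸n+n≡m (≤ᵇ⇒≤ (toℕ x) (toℕ y) (subst T (sym eq) _))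
  ... | false = n , inj₂ refl , m∸n+n≡m (≤-trans (<⇒≤ (toℕ<n x)) (m≤m+n n (toℕ y)))

  dist<n : ∀ (x y : Fin n) → dist n x y < n
  dist<n x y with toℕ x ≤ᵇ toℕ y in eq
  ... | true  = ≤-<-trans (m∸n≤m (toℕ y) (toℕ x)) (toℕ<n y)
  ... | false = +-cancelʳ-< (toℕ x) _ n (begin-strict
        (n + toℕ y ∸ toℕ x) + toℕ x ≡⟨ m∸n+n≡m (≤-trans (<⇒≤ (toℕ<n x)) (m≤m+n n (toℕ y))) ⟩
        n + toℕ y                    <⟨ +-monoʳ-< n (≰⇒> (λ le → subst T eq (≤⇒≤ᵇ le))) ⟩
        n + toℕ x                    ∎)
    where open ≤-Reasoning

  turns-apart : ∀ {s c k m o} → s < n + n → c < n → Turn k → Turn m → Turn o →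
                s + o ≡ (k + m) + c → s ≡ c ⊎ s ≡ n + c
  turns-apart {s} {c} _ _ (inj₁ refl) (inj₁ refl) (inj₁ refl) e =
    inj₁ (trans (sym (+-identityʳ s)) e)
  turns-apart {s} {c} _ c<n (inj₁ refl) (inj₁ refl) (inj₂ refl) e =
    contradiction (subst (n ≤_) e (m≤n+m n s)) (<⇒≱ c<n)
  turns-apart {s} {c} _ _ (inj₁ refl) (inj₂ refl) (inj₁ refl) e =
    inj₂ (trans (sym (+-identityʳ s)) e)
  turns-apart {s} {c} _ _ (inj₁ refl) (inj₂ refl) (inj₂ refl) e =
    inj₁ (+-cancelʳ-≡ n s c (trans e (+-comm n c)))
  turns-apart {s} {c} _ _ (inj₂ refl) (inj₁ refl) (inj₁ refl) e =
    inj₂ (trans (sym (+-identityʳ s)) (trans e (cong (_+ c) (+-identityʳ n))))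
  turns-apart {s} {c} _ _ (inj₂ refl) (inj₁ refl) (inj₂ refl) e =
    inj₁ (+-cancelʳ-≡ n s c (trans e (trans (cong (_+ c) (+-identityʳ n)) (+-comm n c))))
  turns-apart {s} {c} s<2n _ (inj₂ refl) (inj₂ refl) (inj₁ refl) e =
    contradiction (subst (n + n ≤_) (trans (sym e) (+-identityʳ s)) (m≤m+n (n + n) c)) (<⇒≱ s<2n)
  turns-apart {s} {c} _ _ (inj₂ refl) (inj₂ refl) (inj₂ refl) e =
    inj₂ (+-cancelʳ-≡ n s (n + c) (trans e (trans (+-assoc n n c) (+-comm n (n + c)))))

  dist-+ : ∀ (x y z : Fin n) →
    dist n x y + dist n y z ≡ dist n x z ⊎ dist n x y + dist n y z ≡ n + dist n x z
  dist-+ x y z with dist-turn x y | dist-turn y z | dist-turn x z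
  ... | k , k-turn , xy | m , m-turn , yz | o , o-turn , xz =
    turns-apart (+-mono-< (dist<n x y) (dist<n y z)) (dist<n x z) k-turn m-turn o-turn
      (cancel-turns {c = dist n x z} (+-turns {a = dist n x y} {b = dist n y z} xy yz) xz)

  dist-self : ∀ (x : Fin n) → dist n x x ≡ 0
  dist-self x with toℕ x ≤ᵇ toℕ x in eq
  ... | true  = n∸n≡0 (toℕ x)
  ... | false = ⊥-elim (subst T eq (≤⇒≤ᵇ (≤-refl {toℕ x})))

  dist-split : ∀ (i j k : Fin n) → InOpen n i j k → dist n i k + dist n k j ≡ dist n i j
  dist-split i j k (_ , ik<ij) with dist-+ i k j
  ... | inj₁ e = e
  ... | inj₂ e = contradiction (trans e (+-comm n _)) (<⇒≢ (+-mono-< ik<ij (dist<n k j)))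

  -- Walking from i via k to l wraps once around the polygon, so it passes i between k and l.
  InOpen-of-wrap : ∀ (i k l : Fin n) →
    dist n i k + dist n k l ≡ n + dist n i l → 0 < dist n i l → InOpen n k l i
  InOpen-of-wrap i k l e 0<il with dist-+ k i k
  ... | inj₁ f = contradiction (subst (n ≤_) (sym kl≡) (m≤m+n n _)) (<⇒≱ (dist<n k l))
    where
    ik≡0 : dist n i k ≡ 0
    ik≡0 = m+n≡0⇒n≡0 (dist n k i) (trans f (dist-self k))
    kl≡ : dist n k l ≡ n + dist n i l
    kl≡ = trans (cong (_+ dist n k l) (sym ik≡0)) e
  ... | inj₂ f = 0<ki , subst (dist n k i <_) (sym kl≡) (m<m+n (dist n k i) 0<il)
    where
    cycle : dist n k i + dist n i k ≡ n
    cycle = trans f (trans (cong (n +_) (dist-self k)) (+-identityʳ n))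
    0<ki : 0 < dist n k i
    0<ki = n≢0⇒n>0 (λ ki≡0 → <⇒≢ (dist<n i k) (trans (sym (cong (_+ dist n i k) ki≡0)) cycle))
    kl≡ : dist n k l ≡ dist n k i + dist n i l
    kl≡ = +-cancelˡ-≡ (dist n i k) _ _ (begin
      dist n i k + dist n k l                ≡⟨ e ⟩
      n + dist n i l                         ≡⟨ cong (_+ dist n i l) (trans (sym cycle) (+-comm (dist n k i) _)) ⟩
      (dist n i k + dist n k i) + dist n i l ≡⟨ +-assoc (dist n i k) _ _ ⟩
      dist n i k + (dist n k i + dist n i l) ∎)
      where open ≡-Reasoning

  SubInterval-of-first-inside : ∀ (i j k l : Fin n) → InOpen n i j k → ¬ InOpen n k l j → SubInterval n i j k l
  SubInterval-of-first-inside i j k l k∈ij@(_ , ik<ij) j∉kl = begin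
    dist n i k + dist n k l ≤⟨ +-monoʳ-≤ (dist n i k) kl≤kj ⟩
    dist n i k + dist n k j ≡⟨ dist-split i j k k∈ij ⟩
    dist n i j              ∎
    where
    open ≤-Reasoning
    0<kj : 0 < dist n k j
    0<kj = n≢0⇒n>0 (λ kj≡0 → <⇒≢ ik<ij (trans (sym (+-identityʳ _))
             (trans (cong (dist n i k +_) (sym kj≡0)) (dist-split i j k k∈ij))))
    kl≤kj : dist n k l ≤ dist n k j
    kl≤kj = ≮⇒≥ (λ kj<kl → j∉kl (0<kj , kj<kl))

  SubInterval-of-last-inside : ∀ (i j k l : Fin n) → InOpen n i j l → ¬ InOpen n k l i → SubInterval n i j k l
  SubInterval-of-last-inside i j k l (0<il , il<ij) i∉kl with dist-+ i k l
  ... | inj₁ e = ≤-trans (≤-reflexive e) (<⇒≤ il<ij)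
  ... | inj₂ e = contradiction (InOpen-of-wrap i k l e 0<il) i∉kl

  InOpen? : ∀ (i j k : Fin n) → Dec (InOpen n i j k)
  InOpen? i j k = (0 <? dist n i k) ×-dec (dist n i k <? dist n i j)

Overlapping : (n : ℕ) → Fin n → Fin n → Fin n → Fin n → Set
Overlapping n i j k l = (InOpen n i j k ⊎ InOpen n i j l) × (InOpen n k l i ⊎ InOpen n k l j)

EndOK⊎Overlapping : ∀ {n} (i j k l : Fin n) → EndOK n i j k l ⊎ Overlapping n i j k l
EndOK⊎Overlapping i j k l with InOpen? i j k | InOpen? i j l
... | no k∉ij | no l∉ij = inj₁ (inj₁ (k∉ij , l∉ij))
... | yes k∈ij | _ with InOpen? k l j
...   | no j∉kl  = inj₁ (inj₂ (SubInterval-of-first-inside i j k l k∈ij j∉kl))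
...   | yes j∈kl = inj₂ (inj₁ k∈ij , inj₂ j∈kl)
EndOK⊎Overlapping i j k l | no _ | yes l∈ij with InOpen? k l i
...   | no i∉kl  = inj₁ (inj₂ (SubInterval-of-last-inside i j k l l∈ij i∉kl))
...   | yes i∈kl = inj₂ (inj₂ l∈ij , inj₁ i∈kl)

<-positive-combination : ∀ {a b p q} → 0 < a → 0 < b → 0 < p → 0 < q →
                         p < a * p + b * q × q < a * p + b * q
<-positive-combination {a} {b} {p} {q} 0<a 0<b 0<p 0<q =
  ≤-trans (m<m+n p 0<q) p+q≤ , ≤-trans (m<n+m q 0<p) p+q≤
  where
  p+q≤ : p + q ≤ a * p + b * q
  p+q≤ = +-mono-≤ (subst (_≤ a * p) (*-identityˡ p) (*-monoˡ-≤ p 0<a))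
                  (subst (_≤ b * q) (*-identityˡ q) (*-monoˡ-≤ q 0<b))

module _ {n : ℕ} {w : TArc n → ℕ} (F : IsFrieze n w) where
  open IsFrieze F

  X-positive : ∀ (i j : Fin n) → 0 < X w i j
  X-positive i j with 2 ≤? dist n i j | i ≟ᶠ j
  ... | yes p | _     = positive (ord i j p)
  ... | no _  | yes _ = *-mono-≤ (positive (plain i)) (positive (notched i))
  ... | no _  | no _  = ≤-refl

  X-ord : ∀ (i j : Fin n) (p : 2 ≤ dist n i j) → X w i j ≡ w (ord i j p)
  X-ord i j p with 2 ≤? dist n i j
  ... | yes q = cong (w ∘ ord i j) (≤-irrelevant q p)
  ... | no ¬p = contradiction p ¬p

  heavier-inside-unit-arc : ∀ (i j k : Fin n) (p : 2 ≤ dist n i j) (t : Fin n → ℕ) → (∀ x → 0 < t x) →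
    w (ord i j p) ≡ 1 → X w i j * t k ≡ X w i k * t j + X w k j * t i → t i < t k × t j < t k
  heavier-inside-unit-arc i j k p t t-positive ij≡1 exch
    with <-positive-combination (X-positive i k) (X-positive k j) (t-positive j) (t-positive i)
  ... | tj< , ti< = subst (t i <_) (sym tk≡) ti< , subst (t j <_) (sym tk≡) tj<
    where
    tk≡ : t k ≡ X w i k * t j + X w k j * t i
    tk≡ = trans (sym (*-identityˡ (t k))) (trans (cong (_* t k) (sym (trans (X-ord i j p) ij≡1))) exch)

  plain-heavier-inside-unit-arc : ∀ (i j k : Fin n) (p : 2 ≤ dist n i j) → w (ord i j p) ≡ 1 →
    InOpen n i j k → w (plain i) < w (plain k) × w (plain j) < w (plain k)
  plain-heavier-inside-unit-arc i j k p ij≡1 k∈ij =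
    heavier-inside-unit-arc i j k p (w ∘ plain) (positive ∘ plain) ij≡1 (exch-plain i j k k∈ij)

  notched-heavier-inside-unit-arc : ∀ (i j k : Fin n) (p : 2 ≤ dist n i j) → w (ord i j p) ≡ 1 →
    InOpen n i j k → w (notched i) < w (notched k) × w (notched j) < w (notched k)
  notched-heavier-inside-unit-arc i j k p ij≡1 k∈ij =
    heavier-inside-unit-arc i j k p (w ∘ notched) (positive ∘ notched) ij≡1 (exch-notched i j k k∈ij)

  unit-arcs-not-overlapping : ∀ (i j k l : Fin n) (p : 2 ≤ dist n i j) (q : 2 ≤ dist n k l) →
    w (ord i j p) ≡ 1 → w (ord k l q) ≡ 1 → ¬ Overlapping n i j k l
  unit-arcs-not-overlapping i j k l p q ij≡1 kl≡1 = contradict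
    where
    inside-ij : ∀ x → InOpen n i j x → w (plain i) < w (plain x) × w (plain j) < w (plain x)
    inside-ij x = plain-heavier-inside-unit-arc i j x p ij≡1
    inside-kl : ∀ x → InOpen n k l x → w (plain k) < w (plain x) × w (plain l) < w (plain x)
    inside-kl x = plain-heavier-inside-unit-arc k l x q kl≡1
    contradict : ¬ Overlapping n i j k l
    contradict (inj₁ k∈ij , inj₁ i∈kl) = <-asym (proj₁ (inside-ij k k∈ij)) (proj₁ (inside-kl i i∈kl))
    contradict (inj₁ k∈ij , inj₂ j∈kl) = <-asym (proj₂ (inside-ij k k∈ij)) (proj₁ (inside-kl j j∈kl))
    contradict (inj₂ l∈ij , inj₁ i∈kl) = <-asym (proj₁ (inside-ij l l∈ij)) (proj₂ (inside-kl i i∈kl))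
    contradict (inj₂ l∈ij , inj₂ j∈kl) = <-asym (proj₂ (inside-ij l l∈ij)) (proj₂ (inside-kl j j∈kl))

  unit-arcs-EndOK : ∀ (i j k l : Fin n) (p : 2 ≤ dist n i j) (q : 2 ≤ dist n k l) →
    w (ord i j p) ≡ 1 → w (ord k l q) ≡ 1 → EndOK n i j k l
  unit-arcs-EndOK i j k l p q ij≡1 kl≡1 =
    fromInj₁ (⊥-elim ∘ unit-arcs-not-overlapping i j k l p q ij≡1 kl≡1) (EndOK⊎Overlapping i j k l)

  plain-inside-unit-arc-not-unit : ∀ (i j k : Fin n) (p : 2 ≤ dist n i j) → w (ord i j p) ≡ 1 →
    InOpen n i j k → w (plain k) ≢ 1
  plain-inside-unit-arc-not-unit i j k p ij≡1 k∈ij =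
    <⇒≢ (≤-<-trans (positive (plain i)) (proj₁ (plain-heavier-inside-unit-arc i j k p ij≡1 k∈ij))) ∘ sym

  notched-inside-unit-arc-not-unit : ∀ (i j k : Fin n) (p : 2 ≤ dist n i j) → w (ord i j p) ≡ 1 →
    InOpen n i j k → w (notched k) ≢ 1
  notched-inside-unit-arc-not-unit i j k p ij≡1 k∈ij =
    <⇒≢ (≤-<-trans (positive (notched i)) (proj₁ (notched-heavier-inside-unit-arc i j k p ij≡1 k∈ij))) ∘ sym

  unit-plain-notched-same-point : ∀ (i j : Fin n) → w (plain i) ≡ 1 → w (notched j) ≡ 1 → ¬ i ≢ j
  unit-plain-notched-same-point i j i≡1 j≡1 i≢j =
    <⇒≢ (+-mono-≤ (X-positive i j) (X-positive j i)) (trans (sym (cong₂ _*_ i≡1 j≡1)) (exch-tag i j i≢j))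

lemma2p3 : (n : ℕ) → 4 ≤ n → (w : TArc n → ℕ) → IsFrieze n w →
    (α β : TArc n) → w α ≡ 1 → w β ≡ 1 → Compatible α β
lemma2p3 n _ w F (ord i j p) (ord k l q) α≡1 β≡1 crossing =
  crossing (unit-arcs-EndOK F i j k l p q α≡1 β≡1 , unit-arcs-EndOK F k l i j q p β≡1 α≡1)
lemma2p3 n _ w F (ord i j p) (plain k)   α≡1 β≡1 k∈ij = plain-inside-unit-arc-not-unit F i j k p α≡1 k∈ij β≡1
lemma2p3 n _ w F (ord i j p) (notched k) α≡1 β≡1 k∈ij = notched-inside-unit-arc-not-unit F i j k p α≡1 k∈ij β≡1
lemma2p3 n _ w F (plain k)   (ord i j p) α≡1 β≡1 k∈ij = plain-inside-unit-arc-not-unit F i j k p β≡1 k∈ij α≡1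
lemma2p3 n _ w F (notched k) (ord i j p) α≡1 β≡1 k∈ij = notched-inside-unit-arc-not-unit F i j k p β≡1 k∈ij α≡1
lemma2p3 n _ w F (plain i)   (plain j)   _ _ ()
lemma2p3 n _ w F (notched i) (notched j) _ _ ()
lemma2p3 n _ w F (plain i)   (notched j) α≡1 β≡1 = unit-plain-notched-same-point F i j α≡1 β≡1
lemma2p3 n _ w F (notched i) (plain j)   α≡1 β≡1 = λ i≢j → unit-plain-notched-same-point F j i β≡1 α≡1 (i≢j ∘ sym)
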